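{- Let $(T,\mathbf{G})$ be a type-respecting simplified clique decomposition of a Boolean circuit $F$, of width $k$, and let $H$ be its representation graph. Then the treewidth of $H$ is at most $k$.
   Context: Boolean circuits over $\{\vee,\wedge,\neg\}$ (input gates, NOT gates with one input, AND/OR gates with positive fan-in, no constants). Labeled directed graph $(V,E,\mathbf{S})$: $\mathbf{S}$ a partition of $V$ into labels. Simplified clique decomposition (SCD) $(T,\mathbf{G})$: rooted tree, nodes with at most two children, each node $t$ carrying $G(t)$; leaf: $(\{v\},\emptyset,\{\{v\}\})$; two children: union of vertex-disjoint graphs; one child $t_1$: $G(t_1)$ modified by adding a new vertex as a singleton label, by union of two labels $S_1,S_2$ into $S$ ($S_1,S_2$ are then children of $S$), or by adding all arcs from every vertex of label $S_1$ to every vertex of label $S_2$ ($S_1,S_2$ are then called adjacent). Labels of $(T,\mathbf{G})$: all elements of $\bigcup_t\mathbf{S}(G(t))$; width: $\max_t|\mathbf{S}(G(t))|$. It is an SCD of $F$ if the unlabeled root graph is the DAG of $F$; type-respecting if every non-singleton label consists only of input and NOT gates, only of AND gates, or only of OR gates. The representation graph $H$ of $(T,\mathbf{G})$ is the undirected graph whose vertices are the labels of $(T,\mathbf{G})$, with $S_1,S_2$ adjacent iff one is a child of the other or $S_1$ and $S_2$ are adjacent in $(T,\mathbf{G})$. -}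

module Defs where

open import Data.Nat using (ℕ; zero; suc; _≤_; _⊔_)
open import Data.Fin using (Fin; zero; suc; toℕ)
open import Data.Bool using (Bool; T)
import Data.Bool.Properties as BoolP
open import Data.Fin.Subset using (Subset; _∈_; _∉_; ⁅_⁆; _∪_; ∣_∣; ⊤)
open import Data.Vec using (tabulate)
open import Data.Vec.Properties using (≡-dec)
open import Data.List using (List; []; _∷_; _++_; [_]; filter; length)
import Data.List.Membership.Propositional as LMem
open import Data.List.Relation.Unary.All using (All)
open import Data.List.Relation.Unary.Unique.Propositional using (Unique)
open import Data.Product using (Σ; ∃; _×_; _,_)
open import Data.Sum using (_⊎_)
open import Data.Empty using (⊥)
open import Relation.Nullary using (¬_; ¬?)
open import Relation.Binary.PropositionalEquality using (_≡_; _≢_)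
open import Relation.Binary.Definitions using (DecidableEquality)

-- list membership (as opposed to subset membership _∈_ of Data.Fin.Subset)
_∈L_ : {A : Set} → A → List A → Set
x ∈L xs = LMem._∈_ x xs

data Kind : Set where
  input notG andG orG : Kind

-- directed path of length ≥ 1 along arcs (arc u w = true means u → w)
data Path {n : ℕ} (arc : Fin n → Fin n → Bool) : Fin n → Fin n → Set where
  one  : ∀ {u w} → T (arc u w) → Path arc u w
  more : ∀ {u v w} → T (arc u v) → Path arc v w → Path arc u w

indeg : {n : ℕ} → (Fin n → Fin n → Bool) → Fin n → ℕ
indeg arc v = ∣ tabulate (λ u → arc u v) ∣

record Circuit : Set where
  field
    n          : ℕ
    kind       : Fin n → Kind
    arc        : Fin n → Fin n → Bool
    acyclic    : ∀ v → ¬ Path arc v v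
    fanin-inp  : ∀ v → kind v ≡ input → indeg arc v ≡ 0
    fanin-not  : ∀ v → kind v ≡ notG → indeg arc v ≡ 1
    fanin-and  : ∀ v → kind v ≡ andG → 1 ≤ indeg arc v
    fanin-or   : ∀ v → kind v ≡ orG → 1 ≤ indeg arc v

-- The rooted tree T is given as a term; each node t carries the labeled
-- graph G(t) = (verts t, Arcs t, labels t) computed below.

data SCD (n : ℕ) : Set where
  leaf      : Fin n → SCD n                           -- ({v}, ∅, {{v}})
  union     : SCD n → SCD n → SCD n
  addVertex : Fin n → SCD n → SCD n                   -- new singleton label
  merge     : Subset n → Subset n → SCD n → SCD n     -- S1,S2 ↦ S1 ∪ S2
  addArcs   : Subset n → Subset n → SCD n → SCD n     -- all arcs S1 → S2

_≟S_ : {n : ℕ} → DecidableEquality (Subset n)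
_≟S_ = ≡-dec BoolP._≟_

removeS : {n : ℕ} → Subset n → List (Subset n) → List (Subset n)
removeS S = filter (λ X → ¬? (X ≟S S))

verts : {n : ℕ} → SCD n → Subset n
verts (leaf v)        = ⁅ v ⁆
verts (union a b)     = verts a ∪ verts b
verts (addVertex v a) = ⁅ v ⁆ ∪ verts a
verts (merge _ _ a)   = verts a
verts (addArcs _ _ a) = verts a

Arcs : {n : ℕ} → SCD n → Fin n → Fin n → Set
Arcs (leaf v)          u w = ⊥
Arcs (union a b)       u w = Arcs a u w ⊎ Arcs b u w
Arcs (addVertex _ a)   u w = Arcs a u w
Arcs (merge _ _ a)     u w = Arcs a u w
Arcs (addArcs S1 S2 a) u w = Arcs a u w ⊎ (u ∈ S1 × w ∈ S2)

labels : {n : ℕ} → SCD n → List (Subset n)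
labels (leaf v)          = [ ⁅ v ⁆ ]
labels (union a b)       = labels a ++ labels b
labels (addVertex v a)   = ⁅ v ⁆ ∷ labels a
labels (merge S1 S2 a)   = (S1 ∪ S2) ∷ removeS S1 (removeS S2 (labels a))
labels (addArcs _ _ a)   = labels a

WF : {n : ℕ} → SCD n → Set
WF (leaf v)          = Data.Unit.⊤
  where import Data.Unit
WF (union a b)       = WF a × WF b × (∀ v → v ∈ verts a → v ∉ verts b)
WF (addVertex v a)   = WF a × v ∉ verts a
WF (merge S1 S2 a)   = WF a × S1 ∈L labels a × S2 ∈L labels a × S1 ≢ S2
WF (addArcs S1 S2 a) = WF a × S1 ∈L labels a × S2 ∈L labels a

width : {n : ℕ} → SCD n → ℕ
width (leaf v)          = length (labels (leaf v))
width (union a b)       = length (labels (union a b)) ⊔ (width a ⊔ width b)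
width (addVertex v a)   = length (labels (addVertex v a)) ⊔ width a
width (merge S1 S2 a)   = length (labels (merge S1 S2 a)) ⊔ width a
width (addArcs S1 S2 a) = length (labels (addArcs S1 S2 a)) ⊔ width a

-- all labels of the decomposition: ⋃_t S(G(t)) (as a list, possibly with repeats)
allLabels : {n : ℕ} → SCD n → List (Subset n)
allLabels (leaf v)          = labels (leaf v)
allLabels (union a b)       = labels (union a b) ++ (allLabels a ++ allLabels b)
allLabels (addVertex v a)   = labels (addVertex v a) ++ allLabels a
allLabels (merge S1 S2 a)   = labels (merge S1 S2 a) ++ allLabels a
allLabels (addArcs S1 S2 a) = labels (addArcs S1 S2 a) ++ allLabels a

-- ChildOf t S S' : S is a child of S' (S' arose as the union of S and another label)
ChildOf : {n : ℕ} → SCD n → Subset n → Subset n → Set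
ChildOf (leaf v)          S S' = ⊥
ChildOf (union a b)       S S' = ChildOf a S S' ⊎ ChildOf b S S'
ChildOf (addVertex v a)   S S' = ChildOf a S S'
ChildOf (merge S1 S2 a)   S S' = ((S ≡ S1 ⊎ S ≡ S2) × S' ≡ (S1 ∪ S2)) ⊎ ChildOf a S S'
ChildOf (addArcs _ _ a)   S S' = ChildOf a S S'

AdjacentIn : {n : ℕ} → SCD n → Subset n → Subset n → Set
AdjacentIn (leaf v)          S S' = ⊥
AdjacentIn (union a b)       S S' = AdjacentIn a S S' ⊎ AdjacentIn b S S'
AdjacentIn (addVertex v a)   S S' = AdjacentIn a S S'
AdjacentIn (merge _ _ a)     S S' = AdjacentIn a S S'
AdjacentIn (addArcs S1 S2 a) S S' = (S ≡ S1 × S' ≡ S2) ⊎ AdjacentIn a S S'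

IsSCDOf : (F : Circuit) → SCD (Circuit.n F) → Set
IsSCDOf F t = (∀ v → v ∈ verts t)
            × (∀ u w → (Arcs t u w → T (Circuit.arc F u w)) × (T (Circuit.arc F u w) → Arcs t u w))

TypeRespecting : (F : Circuit) → SCD (Circuit.n F) → Set
TypeRespecting F t =
  ∀ S → S ∈L allLabels t → 2 ≤ ∣ S ∣ →
      (∀ v → v ∈ S → Circuit.kind F v ≡ input ⊎ Circuit.kind F v ≡ notG)
    ⊎ (∀ v → v ∈ S → Circuit.kind F v ≡ andG)
    ⊎ (∀ v → v ∈ S → Circuit.kind F v ≡ orG)

RepVertex : {n : ℕ} → SCD n → Subset n → Set
RepVertex t S = S ∈L allLabels t

RepEdge : {n : ℕ} → SCD n → Subset n → Subset n → Set
RepEdge t S S' = ChildOf t S S' ⊎ ChildOf t S' S ⊎ AdjacentIn t S S' ⊎ AdjacentIn t S' S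

-- The decomposition tree has nodes Fin (suc m), root zero, and node suc i
-- has parent (parent i) of strictly smaller index (every finite tree
-- admits such a numbering).

TreeAdj : {m : ℕ} → (Fin m → Fin (suc m)) → Fin (suc m) → Fin (suc m) → Set
TreeAdj {m} parent x y = (Σ (Fin m) λ i → x ≡ suc i × y ≡ parent i)
                       ⊎ (Σ (Fin m) λ i → y ≡ suc i × x ≡ parent i)

data WalkIn {m : ℕ} (parent : Fin m → Fin (suc m)) (Q : Fin (suc m) → Set)
       : Fin (suc m) → Fin (suc m) → Set where
  stop : ∀ {x} → Q x → WalkIn parent Q x x
  step : ∀ {x y z} → Q x → TreeAdj parent x y → WalkIn parent Q y z → WalkIn parent Q x z

module _ {A : Set} (P : A → Set) (E : A → A → Set) where

  record TreeDecomposition : Set where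
    field
      m             : ℕ
      parent        : Fin m → Fin (suc m)
      parent<       : ∀ i → toℕ (parent i) ≤ toℕ i
      bag           : Fin (suc m) → List A
      bagUnique     : ∀ x → Unique (bag x)
      bagVerts      : ∀ x → All P (bag x)
      vertexCovered : ∀ a → P a → ∃ λ x → a ∈L bag x
      edgeCovered   : ∀ a b → P a → P b → E a b → ∃ λ x → a ∈L bag x × b ∈L bag x
      connected     : ∀ a x y → a ∈L bag x → a ∈L bag y →
                      WalkIn parent (λ z → a ∈L bag z) x y

  TreewidthAtMost : ℕ → Set
  TreewidthAtMost k = Σ TreeDecomposition λ D →
    ∀ x → length (TreeDecomposition.bag D x) ≤ suc k

module Submission where

-- The representation graph H has a tree decomposition whose tree
-- is the decomposition tree T itself: the bag of a node t is the label set
-- S(G(t)) of its graph, enlarged at a merge node by the one new label S1 ∪ S2.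
-- Every bag therefore has at most width + 1 labels, so the treewidth of H is
-- at most the width.  Edges of H are covered because a child edge S1,S2 – S1∪S2
-- or an adjacency S1 – S2 is created at a node whose bag holds both labels.
-- The real work is the connectivity of the bags containing a fixed label S.
-- It rests on two invariants: the labels of G(t) partition its vertex set, and
-- every label occurring in a bag below t is a nonempty subset of a label of
-- G(t).  Consequently the labels created at t (the singleton of a fresh vertex,
-- a merged label S1 ∪ S2) never occur below t, and a label of the root bag of
-- t occurring below t is already in the root bag of the child containing it.

open import Defs
open import Data.Nat using (ℕ; suc; _≤_; _+_; _⊔_; z≤n; s≤s)
open import Data.Nat.Properties
  using (+-suc; +-monoʳ-≤; ≤-trans; ≤-refl; ≤-reflexive; m≤m⊔n; m≤n⊔m; n≤1+n)
open import Data.Fin using (Fin; zero; suc; toℕ; _↑ˡ_; _↑ʳ_; splitAt)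
open import Data.Fin.Properties
  using (splitAt-↑ˡ; splitAt-↑ʳ; splitAt⁻¹-↑ˡ; splitAt⁻¹-↑ʳ; toℕ-↑ˡ; toℕ-↑ʳ)
open import Data.Fin.Subset using (Subset; _∈_; _∉_; ⁅_⁆; _∪_; _⊆_; Nonempty)
open import Data.Fin.Subset.Properties using (x∈⁅x⁆; x∈⁅y⁆⇒x≡y; x∈p∪q⁺; x∈p∪q⁻)
open import Data.List using (List; _∷_; length)
open import Data.List.Relation.Unary.Any using (here; there)
import Data.List.Relation.Unary.All as All
open import Data.List.Relation.Unary.AllPairs using ([]; _∷_)
open import Data.List.Membership.Propositional.Properties
  using (∈-++⁺ˡ; ∈-++⁺ʳ; ∈-++⁻; ∈-filter⁺; ∈-filter⁻)
open import Data.List.Relation.Unary.Unique.Propositional using (Unique)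
import Data.List.Relation.Unary.Unique.Propositional.Properties as Unique
open import Data.Product using (∃; _×_; _,_; proj₁; proj₂)
open import Data.Sum using (_⊎_; inj₁; inj₂; [_,_]′; swap)
open import Data.Empty using (⊥; ⊥-elim)
open import Relation.Nullary using (¬_; ¬?; yes; no)
open import Relation.Binary.PropositionalEquality
  using (_≡_; _≢_; refl; sym; trans; cong; subst)

module _ {m : ℕ} {p : Fin m → Fin (suc m)} {Q : Fin (suc m) → Set} where

  walk-start : ∀ {x y} → WalkIn p Q x y → Q x
  walk-start (stop q)     = q
  walk-start (step q _ _) = q

  _++W_ : ∀ {x y z} → WalkIn p Q x y → WalkIn p Q y z → WalkIn p Q x z
  stop _     ++W w' = w'
  step q a w ++W w' = step q a (w ++W w')

  reverseW : ∀ {x y} → WalkIn p Q x y → WalkIn p Q y x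
  reverseW (stop q)     = stop q
  reverseW (step q a w) = reverseW w ++W step (walk-start w) (swap a) (stop q)

mapW : ∀ {m m'} {p : Fin m → Fin (suc m)} {p' : Fin m' → Fin (suc m')}
       {Q : Fin (suc m) → Set} {Q' : Fin (suc m') → Set}
       (f : Fin (suc m) → Fin (suc m')) →
       (∀ {x y} → TreeAdj p x y → TreeAdj p' (f x) (f y)) →
       (∀ {z} → Q z → Q' (f z)) →
       ∀ {x y} → WalkIn p Q x y → WalkIn p' Q' (f x) (f y)
mapW f adj q (stop qx)     = stop (q qx)
mapW f adj q (step qx a w) = step (q qx) (adj a) (mapW f adj q w)

record BagTree (A : Set) : Set where
  field
    m       : ℕ
    parent  : Fin m → Fin (suc m)
    parent< : ∀ i → toℕ (parent i) ≤ toℕ i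
    bag     : Fin (suc m) → List A
open BagTree public

module _ {A : Set} where

  -- some bag, resp. every bag, of R has property P (records, so that P and R
  -- can be inferred from the type)
  record InSome (P : List A → Set) (R : BagTree A) : Set where
    constructor inBag
    field
      node  : Fin (suc (m R))
      holds : P (bag R node)

  record AllBags (P : List A → Set) (R : BagTree A) : Set where
    constructor everyBag
    field
      holds : ∀ x → P (bag R x)

  witness : ∀ {P R} → InSome P R → ∃ λ x → P (bag R x)
  witness (inBag x p) = x , p

  allBags-map : ∀ {P Q R} → (∀ {B} → P B → Q B) → AllBags P R → AllBags Q R
  allBags-map f (everyBag h) = everyBag (λ x → f (h x))

  Occurs : A → BagTree A → Set
  Occurs a R = InSome (a ∈L_) R

  Connected : BagTree A → Set
  Connected R = ∀ a x y → a ∈L bag R x → a ∈L bag R y →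
                WalkIn (parent R) (λ z → a ∈L bag R z) x y

  leafTree : List A → BagTree A
  leafTree B = record { m = 0 ; parent = λ () ; parent< = λ () ; bag = λ _ → B }

  leafTree-connected : ∀ B → Connected (leafTree B)
  leafTree-connected B a zero zero ax _ = stop ax

  node1 : List A → BagTree A → BagTree A
  node1 B R = record { m = suc (m R) ; parent = par ; parent< = par< ; bag = bg }
    where
      par : Fin (suc (m R)) → Fin (suc (suc (m R)))
      par zero    = zero
      par (suc i) = suc (parent R i)
      par< : ∀ i → toℕ (par i) ≤ toℕ i
      par< zero    = z≤n
      par< (suc i) = s≤s (parent< R i)
      bg : Fin (suc (suc (m R))) → List A
      bg zero    = B
      bg (suc x) = bag R x

  node1-in : ∀ {P B R} → InSome P (node1 B R) → P B ⊎ InSome P R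
  node1-in (inBag zero    p) = inj₁ p
  node1-in (inBag (suc x) p) = inj₂ (inBag x p)

  node1-child : ∀ {P B R} → InSome P R → InSome P (node1 B R)
  node1-child (inBag x p) = inBag (suc x) p

  node1-all : ∀ {P B R} → P B → AllBags P R → AllBags P (node1 B R)
  node1-all pB (everyBag pR) = everyBag λ { zero → pB ; (suc x) → pR x }

  node1-connected : ∀ B R → Connected R →
                    (∀ a → a ∈L B → Occurs a R → a ∈L bag R zero) →
                    Connected (node1 B R)
  node1-connected B R conn inRoot = go
    where
      R' = node1 B R
      shiftAdj : ∀ {x y} → TreeAdj (parent R) x y → TreeAdj (parent R') (suc x) (suc y)
      shiftAdj (inj₁ (i , refl , refl)) = inj₁ (suc i , refl , refl)
      shiftAdj (inj₂ (i , refl , refl)) = inj₂ (suc i , refl , refl)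
      shift : ∀ a x y → a ∈L bag R x → a ∈L bag R y →
              WalkIn (parent R') (λ z → a ∈L bag R' z) (suc x) (suc y)
      shift a x y ax ay = mapW suc shiftAdj (λ q → q) (conn a x y ax ay)
      fromRoot : ∀ a y → a ∈L B → a ∈L bag R y →
                 WalkIn (parent R') (λ z → a ∈L bag R' z) zero (suc y)
      fromRoot a y aB ay =
        step aB (inj₂ (zero , refl , refl)) (shift a zero y (inRoot a aB (inBag y ay)) ay)
      go : Connected R'
      go a zero    zero    ax ay = stop ax
      go a zero    (suc y) ax ay = fromRoot a y ax ay
      go a (suc x) zero    ax ay = reverseW (fromRoot a x ay ax)
      go a (suc x) (suc y) ax ay = shift a x y ax ay

data Block (m n : ℕ) : Fin (m + n) → Set where
  left  : (i : Fin m) → Block m n (i ↑ˡ n)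
  right : (j : Fin n) → Block m n (m ↑ʳ j)

block : ∀ m n x → Block m n x
block m n x with splitAt m x in eq
... | inj₁ i = subst (Block m n) (splitAt⁻¹-↑ˡ eq) (left i)
... | inj₂ j = subst (Block m n) (splitAt⁻¹-↑ʳ eq) (right j)

module _ {A : Set} (B : List A) (R1 R2 : BagTree A) where
  private
    m1 = m R1
    m2 = m R2
    M  = suc m1 + suc m2

  embedL : Fin (suc m1) → Fin (suc M)
  embedL x = suc (x ↑ˡ suc m2)

  embedR : Fin (suc m2) → Fin (suc M)
  embedR y = suc (suc m1 ↑ʳ y)

  parentOf : Fin (suc m1) ⊎ Fin (suc m2) → Fin (suc M)
  parentOf (inj₁ zero)    = zero
  parentOf (inj₁ (suc i)) = embedL (parent R1 i)
  parentOf (inj₂ zero)    = zero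
  parentOf (inj₂ (suc j)) = embedR (parent R2 j)

  parent2 : Fin M → Fin (suc M)
  parent2 x = parentOf (splitAt (suc m1) x)

  parent2< : ∀ x → toℕ (parent2 x) ≤ toℕ x
  parent2< x with block (suc m1) (suc m2) x
  ... | left i rewrite splitAt-↑ˡ (suc m1) i (suc m2) = leftBlock i
    where
      leftBlock : ∀ i → toℕ (parentOf (inj₁ i)) ≤ toℕ (i ↑ˡ suc m2)
      leftBlock zero    = z≤n
      leftBlock (suc i) rewrite toℕ-↑ˡ (parent R1 i) (suc m2) | toℕ-↑ˡ i (suc m2) =
        s≤s (parent< R1 i)
  ... | right j rewrite splitAt-↑ʳ (suc m1) (suc m2) j = rightBlock j
    where
      rightBlock : ∀ j → toℕ (parentOf (inj₂ j)) ≤ toℕ (suc m1 ↑ʳ j)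
      rightBlock zero    = z≤n
      rightBlock (suc j) rewrite toℕ-↑ʳ (suc m1) (parent R2 j) | toℕ-↑ʳ (suc m1) (suc j) =
        s≤s (≤-trans (s≤s (+-monoʳ-≤ m1 (parent< R2 j)))
                     (≤-reflexive (sym (+-suc m1 (toℕ j)))))

  bag2 : Fin (suc M) → List A
  bag2 zero    = B
  bag2 (suc x) = [ bag R1 , bag R2 ]′ (splitAt (suc m1) x)

  node2 : BagTree A
  node2 = record { m = M ; parent = parent2 ; parent< = parent2< ; bag = bag2 }

  bag-embedL : ∀ x → bag2 (embedL x) ≡ bag R1 x
  bag-embedL x rewrite splitAt-↑ˡ (suc m1) x (suc m2) = refl

  bag-embedR : ∀ y → bag2 (embedR y) ≡ bag R2 y
  bag-embedR y rewrite splitAt-↑ʳ (suc m1) (suc m2) y = refl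

  node2-in : ∀ {P} → InSome P node2 → P B ⊎ InSome P R1 ⊎ InSome P R2
  node2-in (inBag zero p) = inj₁ p
  node2-in {P} (inBag (suc x) p) with block (suc m1) (suc m2) x
  ... | left i  = inj₂ (inj₁ (inBag i (subst P (bag-embedL i) p)))
  ... | right j = inj₂ (inj₂ (inBag j (subst P (bag-embedR j) p)))

  node2-left : ∀ {P} → InSome P R1 → InSome P node2
  node2-left {P} (inBag x p) = inBag (embedL x) (subst P (sym (bag-embedL x)) p)

  node2-right : ∀ {P} → InSome P R2 → InSome P node2
  node2-right {P} (inBag y p) = inBag (embedR y) (subst P (sym (bag-embedR y)) p)

  node2-all : ∀ {P} → P B → AllBags P R1 → AllBags P R2 → AllBags P node2
  node2-all {P} pB (everyBag p1) (everyBag p2) = everyBag every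
    where
      every : ∀ x → P (bag2 x)
      every zero = pB
      every (suc x) with block (suc m1) (suc m2) x
      ... | left i  = subst P (sym (bag-embedL i)) (p1 i)
      ... | right j = subst P (sym (bag-embedR j)) (p2 j)

  parent-embedL : ∀ i → embedL (parent R1 i) ≡ parent2 (suc i ↑ˡ suc m2)
  parent-embedL i = sym (cong parentOf (splitAt-↑ˡ (suc m1) (suc i) (suc m2)))

  parent-embedR : ∀ j → parentOf (inj₂ j) ≡ parent2 (suc m1 ↑ʳ j)
  parent-embedR j = sym (cong parentOf (splitAt-↑ʳ (suc m1) (suc m2) j))

  adj-embedL : ∀ {x y} → TreeAdj (parent R1) x y → TreeAdj parent2 (embedL x) (embedL y)
  adj-embedL (inj₁ (i , refl , refl)) = inj₁ (suc i ↑ˡ suc m2 , refl , parent-embedL i)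
  adj-embedL (inj₂ (i , refl , refl)) = inj₂ (suc i ↑ˡ suc m2 , refl , parent-embedL i)

  adj-embedR : ∀ {x y} → TreeAdj (parent R2) x y → TreeAdj parent2 (embedR x) (embedR y)
  adj-embedR (inj₁ (i , refl , refl)) = inj₁ (suc m1 ↑ʳ suc i , refl , parent-embedR (suc i))
  adj-embedR (inj₂ (i , refl , refl)) = inj₂ (suc m1 ↑ʳ suc i , refl , parent-embedR (suc i))

  root-adjL : TreeAdj parent2 zero (embedL zero)
  root-adjL = inj₂ (zero ↑ˡ suc m2 , refl , refl)

  root-adjR : TreeAdj parent2 zero (embedR zero)
  root-adjR = inj₂ (suc m1 ↑ʳ zero , refl , parent-embedR zero)

  Walk2 : A → Fin (suc M) → Fin (suc M) → Set
  Walk2 a = WalkIn parent2 (λ z → a ∈L bag2 z)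

  walkL : ∀ {a x y} → WalkIn (parent R1) (λ z → a ∈L bag R1 z) x y →
          Walk2 a (embedL x) (embedL y)
  walkL {a} = mapW embedL adj-embedL (λ {z} → subst (a ∈L_) (sym (bag-embedL z)))

  walkR : ∀ {a x y} → WalkIn (parent R2) (λ z → a ∈L bag R2 z) x y →
          Walk2 a (embedR x) (embedR y)
  walkR {a} = mapW embedR adj-embedR (λ {z} → subst (a ∈L_) (sym (bag-embedR z)))

  node2-connected : Connected R1 → Connected R2 →
                    (∀ a → a ∈L B → Occurs a R1 → a ∈L bag R1 zero) →
                    (∀ a → a ∈L B → Occurs a R2 → a ∈L bag R2 zero) →
                    (∀ a → Occurs a R1 → Occurs a R2 → a ∈L B) →
                    Connected node2
  node2-connected c1 c2 inRoot1 inRoot2 shared = go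
    where
      outL : ∀ {a z} → a ∈L bag2 (embedL z) → a ∈L bag R1 z
      outL {a} {z} = subst (a ∈L_) (bag-embedL z)
      outR : ∀ {a z} → a ∈L bag2 (embedR z) → a ∈L bag R2 z
      outR {a} {z} = subst (a ∈L_) (bag-embedR z)
      toL : ∀ a y → a ∈L B → a ∈L bag R1 y → Walk2 a zero (embedL y)
      toL a y aB ay = step aB root-adjL (walkL (c1 a zero y (inRoot1 a aB (inBag y ay)) ay))
      toR : ∀ a y → a ∈L B → a ∈L bag R2 y → Walk2 a zero (embedR y)
      toR a y aB ay = step aB root-adjR (walkR (c2 a zero y (inRoot2 a aB (inBag y ay)) ay))
      fromRoot : ∀ a y → a ∈L B → a ∈L bag2 y → Walk2 a zero y
      fromRoot a zero    aB ay = stop aB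
      fromRoot a (suc y) aB ay with block (suc m1) (suc m2) y
      ... | left j  = toL a j aB (outL ay)
      ... | right j = toR a j aB (outR ay)
      go : Connected node2
      go a zero    y       ax ay = fromRoot a y ax ay
      go a (suc x) zero    ax ay = reverseW (fromRoot a (suc x) ay ax)
      go a (suc x) (suc y) ax ay with block (suc m1) (suc m2) x | block (suc m1) (suc m2) y
      ... | left i  | left j  = walkL (c1 a i j (outL ax) (outL ay))
      ... | right i | right j = walkR (c2 a i j (outR ax) (outR ay))
      ... | left i  | right j = reverseW (toL a i aB (outL ax)) ++W toR a j aB (outR ay)
        where aB = shared a (inBag i (outL ax)) (inBag j (outR ay))
      ... | right i | left j  = reverseW (toR a i aB (outR ax)) ++W toL a j aB (outL ay)
        where aB = shared a (inBag j (outL ay)) (inBag i (outR ax))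

module _ {n : ℕ} where

  kept⁻ : ∀ {S1 S2 L : Subset n} xs → L ∈L removeS S1 (removeS S2 xs) →
          L ∈L xs × L ≢ S1 × L ≢ S2
  kept⁻ {S1} {S2} xs p with ∈-filter⁻ (λ X → ¬? (X ≟S S1)) {xs = removeS S2 xs} p
  ... | p' , L≢S1 with ∈-filter⁻ (λ X → ¬? (X ≟S S2)) {xs = xs} p'
  ... | p'' , L≢S2 = p'' , L≢S1 , L≢S2

  kept⁺ : ∀ {S1 S2 L : Subset n} xs → L ∈L xs → L ≢ S1 → L ≢ S2 →
          L ∈L removeS S1 (removeS S2 xs)
  kept⁺ {S1} {S2} xs p L≢S1 L≢S2 =
    ∈-filter⁺ (λ X → ¬? (X ≟S S1)) (∈-filter⁺ (λ X → ¬? (X ≟S S2)) p L≢S2) L≢S1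

  merged⁻ : ∀ {S1 S2 L : Subset n} xs → L ∈L ((S1 ∪ S2) ∷ removeS S1 (removeS S2 xs)) →
            L ≡ S1 ∪ S2 ⊎ (L ∈L xs × L ≢ S1 × L ≢ S2)
  merged⁻ xs (here e)  = inj₁ e
  merged⁻ xs (there p) = inj₂ (kept⁻ xs p)

  labels-nonempty : ∀ (t : SCD n) → WF t → ∀ {L} → L ∈L labels t → Nonempty L
  labels-nonempty (leaf v) _ (here refl) = v , x∈⁅x⁆ v
  labels-nonempty (union a b) (wa , wb , _) p with ∈-++⁻ (labels a) p
  ... | inj₁ q = labels-nonempty a wa q
  ... | inj₂ q = labels-nonempty b wb q
  labels-nonempty (addVertex v a) _ (here refl) = v , x∈⁅x⁆ v
  labels-nonempty (addVertex v a) (wa , _) (there p) = labels-nonempty a wa p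
  labels-nonempty (merge S1 S2 a) (wa , p1 , _) p with merged⁻ (labels a) p
  ... | inj₁ refl        = proj₁ S1-nonempty , x∈p∪q⁺ (inj₁ (proj₂ S1-nonempty))
    where S1-nonempty = labels-nonempty a wa p1
  ... | inj₂ (q , _ , _) = labels-nonempty a wa q
  labels-nonempty (addArcs S1 S2 a) (wa , _) p = labels-nonempty a wa p

  labels⊆verts : ∀ (t : SCD n) → WF t → ∀ {L} → L ∈L labels t → L ⊆ verts t
  labels⊆verts (leaf v) _ (here refl) = λ r → r
  labels⊆verts (union a b) (wa , wb , _) p with ∈-++⁻ (labels a) p
  ... | inj₁ q = λ r → x∈p∪q⁺ (inj₁ (labels⊆verts a wa q r))
  ... | inj₂ q = λ r → x∈p∪q⁺ (inj₂ (labels⊆verts b wb q r))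
  labels⊆verts (addVertex v a) _ (here refl) = λ r → x∈p∪q⁺ (inj₁ r)
  labels⊆verts (addVertex v a) (wa , _) (there p) = λ r → x∈p∪q⁺ (inj₂ (labels⊆verts a wa p r))
  labels⊆verts (merge S1 S2 a) (wa , p1 , p2 , _) p with merged⁻ (labels a) p
  ... | inj₁ refl        = λ r → [ labels⊆verts a wa p1 , labels⊆verts a wa p2 ]′ (x∈p∪q⁻ S1 S2 r)
  ... | inj₂ (q , _ , _) = labels⊆verts a wa q
  labels⊆verts (addArcs S1 S2 a) (wa , _) p = labels⊆verts a wa p

  merged-apart : ∀ {S1 S2 : Subset n} {xs} →
                 (∀ {L L' v} → L ∈L xs → L' ∈L xs → v ∈ L → v ∈ L' → L ≡ L') →
                 S1 ∈L xs → S2 ∈L xs →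
                 ∀ {L v} → L ∈L xs → L ≢ S1 → L ≢ S2 → v ∈ L → v ∉ S1 ∪ S2
  merged-apart {S1} {S2} disjoint p1 p2 q L≢S1 L≢S2 v∈L v∈S1∪S2 with x∈p∪q⁻ S1 S2 v∈S1∪S2
  ... | inj₁ v∈S1 = L≢S1 (disjoint q p1 v∈L v∈S1)
  ... | inj₂ v∈S2 = L≢S2 (disjoint q p2 v∈L v∈S2)

  labels-disjoint : ∀ (t : SCD n) → WF t → ∀ {L L' v} → L ∈L labels t → L' ∈L labels t →
                    v ∈ L → v ∈ L' → L ≡ L'
  labels-disjoint (leaf v) _ (here refl) (here refl) _ _ = refl
  labels-disjoint (union a b) (wa , wb , d) p p' x x' with ∈-++⁻ (labels a) p | ∈-++⁻ (labels a) p'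
  ... | inj₁ q | inj₁ q' = labels-disjoint a wa q q' x x'
  ... | inj₂ q | inj₂ q' = labels-disjoint b wb q q' x x'
  ... | inj₁ q | inj₂ q' = ⊥-elim (d _ (labels⊆verts a wa q x) (labels⊆verts b wb q' x'))
  ... | inj₂ q | inj₁ q' = ⊥-elim (d _ (labels⊆verts a wa q' x') (labels⊆verts b wb q x))
  labels-disjoint (addVertex v a) _ (here refl) (here refl) _ _ = refl
  labels-disjoint (addVertex v a) (wa , v∉a) (here refl) (there q') x x'
    rewrite x∈⁅y⁆⇒x≡y v x = ⊥-elim (v∉a (labels⊆verts a wa q' x'))
  labels-disjoint (addVertex v a) (wa , v∉a) (there q) (here refl) x x'
    rewrite x∈⁅y⁆⇒x≡y v x' = ⊥-elim (v∉a (labels⊆verts a wa q x))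
  labels-disjoint (addVertex v a) (wa , _) (there q) (there q') x x' =
    labels-disjoint a wa q q' x x'
  labels-disjoint (merge S1 S2 a) (wa , p1 , p2 , _) p p' x x'
    with merged⁻ (labels a) p | merged⁻ (labels a) p'
  ... | inj₁ e | inj₁ e' = trans e (sym e')
  ... | inj₁ refl | inj₂ (q' , L'≢S1 , L'≢S2) =
    ⊥-elim (merged-apart (labels-disjoint a wa) p1 p2 q' L'≢S1 L'≢S2 x' x)
  ... | inj₂ (q , L≢S1 , L≢S2) | inj₁ refl =
    ⊥-elim (merged-apart (labels-disjoint a wa) p1 p2 q L≢S1 L≢S2 x x')
  ... | inj₂ (q , _ , _) | inj₂ (q' , _ , _) = labels-disjoint a wa q q' x x'
  labels-disjoint (addArcs S1 S2 a) (wa , _) p p' x x' = labels-disjoint a wa p p' x x'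

  merged-fresh : ∀ S1 S2 (a : SCD n) → WF (merge S1 S2 a) → ∀ {L} → L ∈L labels a → ¬ (S1 ∪ S2) ⊆ L
  merged-fresh S1 S2 a (wa , p1 , p2 , S1≢S2) p ⊆L =
    S1≢S2 (trans (S1≡L p1 inj₁) (sym (S1≡L p2 inj₂)))
    where
      S1≡L : ∀ {S} → S ∈L labels a → (∀ {x} → x ∈ S → x ∈ S1 ⊎ x ∈ S2) → S ≡ _
      S1≡L q side = labels-disjoint a wa q p x∈S (⊆L (x∈p∪q⁺ (side x∈S)))
        where x∈S = proj₂ (labels-nonempty a wa q)

  labels-unique : ∀ (t : SCD n) → WF t → Unique (labels t)
  labels-unique (leaf v) _ = All.[] ∷ []
  labels-unique (union a b) (wa , wb , d) =
    Unique.++⁺ (labels-unique a wa) (labels-unique b wb) apart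
    where apart : ∀ {L} → ¬ (L ∈L labels a × L ∈L labels b)
          apart (p , q) = d _ (labels⊆verts a wa p x∈L) (labels⊆verts b wb q x∈L)
            where x∈L = proj₂ (labels-nonempty a wa p)
  labels-unique (addVertex v a) (wa , v∉a) = All.tabulate new ∷ labels-unique a wa
    where new : ∀ {L} → L ∈L labels a → ⁅ v ⁆ ≢ L
          new p refl = v∉a (labels⊆verts a wa p (x∈⁅x⁆ v))
  labels-unique (merge S1 S2 a) w@(wa , _) =
    All.tabulate new ∷ Unique.filter⁺ (λ X → ¬? (X ≟S S1))
                         (Unique.filter⁺ (λ X → ¬? (X ≟S S2)) (labels-unique a wa))
    where new : ∀ {L} → L ∈L removeS S1 (removeS S2 (labels a)) → (S1 ∪ S2) ≢ L
          new p refl = merged-fresh S1 S2 a w (proj₁ (kept⁻ (labels a) p)) (λ r → r)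
  labels-unique (addArcs S1 S2 a) (wa , _) = labels-unique a wa

module _ {n : ℕ} where

  rootBag : SCD n → List (Subset n)
  rootBag (leaf v)          = labels (leaf v)
  rootBag (union a b)       = labels (union a b)
  rootBag (addVertex v a)   = labels (addVertex v a)
  rootBag (merge S1 S2 a)   = (S1 ∪ S2) ∷ labels a
  rootBag (addArcs S1 S2 a) = labels (addArcs S1 S2 a)

  decomp : SCD n → BagTree (Subset n)
  decomp t@(leaf v)          = leafTree (rootBag t)
  decomp t@(union a b)       = node2 (rootBag t) (decomp a) (decomp b)
  decomp t@(addVertex v a)   = node1 (rootBag t) (decomp a)
  decomp t@(merge S1 S2 a)   = node1 (rootBag t) (decomp a)
  decomp t@(addArcs S1 S2 a) = node1 (rootBag t) (decomp a)

  labels⊆rootBag : ∀ (t : SCD n) {L} → L ∈L labels t → L ∈L bag (decomp t) zero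
  labels⊆rootBag (leaf v)          p = p
  labels⊆rootBag (union a b)       p = p
  labels⊆rootBag (addVertex v a)   p = p
  labels⊆rootBag (merge S1 S2 a)   p with merged⁻ (labels a) p
  ... | inj₁ refl        = here refl
  ... | inj₂ (q , _ , _) = there q
  labels⊆rootBag (addArcs S1 S2 a) p = p

  WithinLabel : List (Subset n) → Subset n → Set
  WithinLabel xs S = Nonempty S × ∃ λ L → L ∈L xs × S ⊆ L

  Grows : List (Subset n) → List (Subset n) → Set
  Grows xs ys = ∀ {L} → L ∈L xs → ∃ λ L' → L' ∈L ys × L ⊆ L'

  within-grows : ∀ {xs ys S} → Grows xs ys → WithinLabel xs S → WithinLabel ys S
  within-grows grows (ne , L , p , S⊆L) with grows p
  ... | L' , p' , L⊆L' = ne , L' , p' , λ r → L⊆L' (S⊆L r)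

  label-within : ∀ (t : SCD n) → WF t → ∀ {L} → L ∈L labels t → WithinLabel (labels t) L
  label-within t w p = labels-nonempty t w p , _ , p , λ r → r

  merge-grows : ∀ S1 S2 (a : SCD n) → Grows (labels a) (labels (merge S1 S2 a))
  merge-grows S1 S2 a {L} p with L ≟S S1
  ... | yes refl = S1 ∪ S2 , here refl , λ r → x∈p∪q⁺ (inj₁ r)
  ... | no L≢S1 with L ≟S S2
  ...   | yes refl  = S1 ∪ S2 , here refl , λ r → x∈p∪q⁺ (inj₂ r)
  ...   | no L≢S2 = L , there (kept⁺ (labels a) p L≢S1 L≢S2) , λ r → r

  unchanged-grows : ∀ {xs ys} → (∀ {L} → L ∈L xs → L ∈L ys) → Grows xs ys
  unchanged-grows sub p = _ , sub p , λ r → r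

  rootBag-within : ∀ (t : SCD n) → WF t → ∀ {S} → S ∈L rootBag t → WithinLabel (labels t) S
  rootBag-within (leaf v)          w p         = label-within (leaf v) w p
  rootBag-within (union a b)       w p         = label-within (union a b) w p
  rootBag-within (addVertex v a)   w p         = label-within (addVertex v a) w p
  rootBag-within (merge S1 S2 a)   w (here refl) = label-within (merge S1 S2 a) w (here refl)
  rootBag-within (merge S1 S2 a)   (wa , _) (there p) =
    within-grows (merge-grows S1 S2 a) (label-within a wa p)
  rootBag-within (addArcs S1 S2 a) w p         = label-within (addArcs S1 S2 a) w p

  occurs-within : ∀ (t : SCD n) → WF t → ∀ {S} → Occurs S (decomp t) → WithinLabel (labels t) S
  occurs-within (leaf v) w (inBag _ p) = rootBag-within (leaf v) w p
  occurs-within (union a b) w@(wa , wb , _) o with node2-in _ (decomp a) (decomp b) o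
  ... | inj₁ p         = rootBag-within (union a b) w p
  ... | inj₂ (inj₁ oa) = within-grows (unchanged-grows ∈-++⁺ˡ) (occurs-within a wa oa)
  ... | inj₂ (inj₂ ob) = within-grows (unchanged-grows (∈-++⁺ʳ (labels a))) (occurs-within b wb ob)
  occurs-within (addVertex v a) w@(wa , _) o with node1-in o
  ... | inj₁ p  = rootBag-within (addVertex v a) w p
  ... | inj₂ oa = within-grows (unchanged-grows there) (occurs-within a wa oa)
  occurs-within (merge S1 S2 a) w@(wa , _) o with node1-in o
  ... | inj₁ p  = rootBag-within (merge S1 S2 a) w p
  ... | inj₂ oa = within-grows (merge-grows S1 S2 a) (occurs-within a wa oa)
  occurs-within (addArcs S1 S2 a) w@(wa , _) o with node1-in o
  ... | inj₁ p  = rootBag-within (addArcs S1 S2 a) w p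
  ... | inj₂ oa = occurs-within a wa oa

  occurs-in-verts : ∀ (t : SCD n) → WF t → ∀ {S} → Occurs S (decomp t) → Nonempty S × S ⊆ verts t
  occurs-in-verts t w o with occurs-within t w o
  ... | ne , L , p , S⊆L = ne , λ r → labels⊆verts t w p (S⊆L r)

  union-apart : ∀ (a b : SCD n) → WF (union a b) → ∀ {S} →
                Occurs S (decomp a) → Occurs S (decomp b) → ⊥
  union-apart a b (wa , wb , disjoint) oa ob
    with occurs-in-verts a wa oa | occurs-in-verts b wb ob
  ... | (x , x∈S) , S⊆a | _ , S⊆b = disjoint x (S⊆a x∈S) (S⊆b x∈S)

  -- The bags containing a label form a subtree: the new labels at the root
  -- (a fresh singleton, a merged label) never occur below it.
  decomp-connected : ∀ (t : SCD n) → WF t → Connected (decomp t)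
  decomp-connected (leaf v) _ = leafTree-connected _
  decomp-connected (union a b) w@(wa , wb , _) =
    node2-connected _ (decomp a) (decomp b) (decomp-connected a wa) (decomp-connected b wb)
      inRootA inRootB (λ S oa ob → ⊥-elim (union-apart a b w oa ob))
    where
      inRootA : ∀ S → S ∈L labels (union a b) → Occurs S (decomp a) → S ∈L bag (decomp a) zero
      inRootA S p oa with ∈-++⁻ (labels a) p
      ... | inj₁ q = labels⊆rootBag a q
      ... | inj₂ q = ⊥-elim (union-apart a b w oa (inBag zero (labels⊆rootBag b q)))
      inRootB : ∀ S → S ∈L labels (union a b) → Occurs S (decomp b) → S ∈L bag (decomp b) zero
      inRootB S p ob with ∈-++⁻ (labels a) p
      ... | inj₁ q = ⊥-elim (union-apart a b w (inBag zero (labels⊆rootBag a q)) ob)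
      ... | inj₂ q = labels⊆rootBag b q
  decomp-connected (addVertex v a) (wa , v∉a) =
    node1-connected _ (decomp a) (decomp-connected a wa) inRoot
    where
      inRoot : ∀ S → S ∈L (⁅ v ⁆ ∷ labels a) → Occurs S (decomp a) → S ∈L bag (decomp a) zero
      inRoot S (here refl) oa = ⊥-elim (v∉a (proj₂ (occurs-in-verts a wa oa) (x∈⁅x⁆ v)))
      inRoot S (there p)   _  = labels⊆rootBag a p
  decomp-connected (merge S1 S2 a) w@(wa , _) =
    node1-connected _ (decomp a) (decomp-connected a wa) inRoot
    where
      inRoot : ∀ S → S ∈L ((S1 ∪ S2) ∷ labels a) → Occurs S (decomp a) → S ∈L bag (decomp a) zero
      inRoot S (here refl) oa with occurs-within a wa oa
      ... | _ , L , p , S⊆L = ⊥-elim (merged-fresh S1 S2 a w p S⊆L)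
      inRoot S (there p) _ = labels⊆rootBag a p
  decomp-connected (addArcs S1 S2 a) (wa , _) =
    node1-connected _ (decomp a) (decomp-connected a wa) (λ S p _ → labels⊆rootBag a p)

  Small : ℕ → List (Subset n) → Set
  Small k B = Unique B × length B ≤ suc k

  small-mono : ∀ {k k' B} → k ≤ k' → Small k B → Small k' B
  small-mono k≤k' (unique , len) = unique , ≤-trans len (s≤s k≤k')

  labels-length : ∀ (t : SCD n) → length (labels t) ≤ width t
  labels-length (leaf v)          = ≤-refl
  labels-length (union a b)       = m≤m⊔n _ (width a ⊔ width b)
  labels-length (addVertex v a)   = m≤m⊔n _ (width a)
  labels-length (merge S1 S2 a)   = m≤m⊔n _ (width a)
  labels-length (addArcs S1 S2 a) = m≤m⊔n _ (width a)

  width-left : ∀ (a b : SCD n) → width a ≤ width (union a b)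
  width-left a b = ≤-trans (m≤m⊔n (width a) (width b)) (m≤n⊔m (length (labels (union a b))) _)

  width-right : ∀ (a b : SCD n) → width b ≤ width (union a b)
  width-right a b = ≤-trans (m≤n⊔m (width a) (width b)) (m≤n⊔m (length (labels (union a b))) _)

  -- The root bag is small: it is the label list, or at a merge node the label
  -- list of the child (at most width many) plus the new label.
  rootBag-small : ∀ (t : SCD n) → WF t → Small (width t) (rootBag t)
  rootBag-small (merge S1 S2 a) w@(wa , _) =
    All.tabulate new ∷ labels-unique a wa ,
    s≤s (≤-trans (labels-length a) (m≤n⊔m (length (labels (merge S1 S2 a))) (width a)))
    where new : ∀ {L} → L ∈L labels a → (S1 ∪ S2) ≢ L
          new p refl = merged-fresh S1 S2 a w p (λ r → r)
  rootBag-small t@(leaf _)        w = labels-unique t w , ≤-trans (labels-length t) (n≤1+n _)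
  rootBag-small t@(union _ _)     w = labels-unique t w , ≤-trans (labels-length t) (n≤1+n _)
  rootBag-small t@(addVertex _ _) w = labels-unique t w , ≤-trans (labels-length t) (n≤1+n _)
  rootBag-small t@(addArcs _ _ _) w = labels-unique t w , ≤-trans (labels-length t) (n≤1+n _)

  decomp-small : ∀ (t : SCD n) → WF t → AllBags (Small (width t)) (decomp t)
  decomp-small t@(leaf v) w = everyBag (λ _ → rootBag-small t w)
  decomp-small t@(union a b) w@(wa , wb , _) =
    node2-all _ (decomp a) (decomp b) (rootBag-small t w)
      (allBags-map (small-mono (width-left a b)) (decomp-small a wa))
      (allBags-map (small-mono (width-right a b)) (decomp-small b wb))
  decomp-small t@(addVertex v a) w@(wa , _) =
    node1-all (rootBag-small t w) (allBags-map (small-mono (m≤n⊔m _ (width a))) (decomp-small a wa))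
  decomp-small t@(merge S1 S2 a) w@(wa , _) =
    node1-all (rootBag-small t w) (allBags-map (small-mono (m≤n⊔m _ (width a))) (decomp-small a wa))
  decomp-small t@(addArcs S1 S2 a) w@(wa , _) =
    node1-all (rootBag-small t w) (allBags-map (small-mono (m≤n⊔m _ (width a))) (decomp-small a wa))

  labels⊆allLabels : ∀ (t : SCD n) {L} → L ∈L labels t → L ∈L allLabels t
  labels⊆allLabels (leaf v)          p = p
  labels⊆allLabels (union a b)       p = ∈-++⁺ˡ p
  labels⊆allLabels (addVertex v a)   p = ∈-++⁺ˡ p
  labels⊆allLabels (merge S1 S2 a)   p = ∈-++⁺ˡ p
  labels⊆allLabels (addArcs S1 S2 a) p = ∈-++⁺ˡ p

  rootBag⊆allLabels : ∀ (t : SCD n) {L} → L ∈L rootBag t → L ∈L allLabels t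
  rootBag⊆allLabels (merge S1 S2 a) (here refl) = ∈-++⁺ˡ {ys = allLabels a} (here refl)
  rootBag⊆allLabels (merge S1 S2 a) (there p)   =
    ∈-++⁺ʳ (labels (merge S1 S2 a)) (labels⊆allLabels a p)
  rootBag⊆allLabels t@(leaf _)        p = labels⊆allLabels t p
  rootBag⊆allLabels t@(union _ _)     p = labels⊆allLabels t p
  rootBag⊆allLabels t@(addVertex _ _) p = labels⊆allLabels t p
  rootBag⊆allLabels t@(addArcs _ _ _) p = labels⊆allLabels t p

  occurs⇒label : ∀ (t : SCD n) {S} → Occurs S (decomp t) → S ∈L allLabels t
  occurs⇒label t@(leaf v) (inBag _ p) = rootBag⊆allLabels t p
  occurs⇒label t@(union a b) o with node2-in _ (decomp a) (decomp b) o
  ... | inj₁ p         = rootBag⊆allLabels t p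
  ... | inj₂ (inj₁ oa) = ∈-++⁺ʳ (labels t) (∈-++⁺ˡ (occurs⇒label a oa))
  ... | inj₂ (inj₂ ob) = ∈-++⁺ʳ (labels t) (∈-++⁺ʳ (allLabels a) (occurs⇒label b ob))
  occurs⇒label t@(addVertex v a) o with node1-in o
  ... | inj₁ p  = rootBag⊆allLabels t p
  ... | inj₂ oa = ∈-++⁺ʳ (labels t) (occurs⇒label a oa)
  occurs⇒label t@(merge S1 S2 a) o with node1-in o
  ... | inj₁ p  = rootBag⊆allLabels t p
  ... | inj₂ oa = ∈-++⁺ʳ (labels t) (occurs⇒label a oa)
  occurs⇒label t@(addArcs S1 S2 a) o with node1-in o
  ... | inj₁ p  = rootBag⊆allLabels t p
  ... | inj₂ oa = ∈-++⁺ʳ (labels t) (occurs⇒label a oa)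

  label⇒occurs : ∀ (t : SCD n) {S} → S ∈L allLabels t → Occurs S (decomp t)
  label⇒occurs t@(leaf v) p = inBag zero p
  label⇒occurs t@(union a b) p with ∈-++⁻ (labels t) p
  ... | inj₁ q = inBag zero (labels⊆rootBag t q)
  ... | inj₂ q with ∈-++⁻ (allLabels a) q
  ...   | inj₁ r = node2-left _ (decomp a) (decomp b) (label⇒occurs a r)
  ...   | inj₂ r = node2-right _ (decomp a) (decomp b) (label⇒occurs b r)
  label⇒occurs t@(addVertex v a) p with ∈-++⁻ (labels t) p
  ... | inj₁ q = inBag zero (labels⊆rootBag t q)
  ... | inj₂ q = node1-child (label⇒occurs a q)
  label⇒occurs t@(merge S1 S2 a) p with ∈-++⁻ (labels t) p
  ... | inj₁ q = inBag zero (labels⊆rootBag t q)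
  ... | inj₂ q = node1-child (label⇒occurs a q)
  label⇒occurs t@(addArcs S1 S2 a) p with ∈-++⁻ (labels t) p
  ... | inj₁ q = inBag zero (labels⊆rootBag t q)
  ... | inj₂ q = node1-child (label⇒occurs a q)

  Together : Subset n → Subset n → List (Subset n) → Set
  Together S S' B = S ∈L B × S' ∈L B

  child-covered : ∀ (t : SCD n) → WF t → ∀ {S S'} → ChildOf t S S' →
                  InSome (Together S S') (decomp t)
  child-covered (union a b) (wa , _) (inj₁ c) =
    node2-left _ (decomp a) (decomp b) (child-covered a wa c)
  child-covered (union a b) (_ , wb , _) (inj₂ c) =
    node2-right _ (decomp a) (decomp b) (child-covered b wb c)
  child-covered (addVertex v a) (wa , _) c = node1-child (child-covered a wa c)
  child-covered (merge S1 S2 a) (_ , p1 , _)     (inj₁ (inj₁ refl , refl)) =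
    inBag zero (there p1 , here refl)
  child-covered (merge S1 S2 a) (_ , _ , p2 , _) (inj₁ (inj₂ refl , refl)) =
    inBag zero (there p2 , here refl)
  child-covered (merge S1 S2 a) (wa , _) (inj₂ c) = node1-child (child-covered a wa c)
  child-covered (addArcs S1 S2 a) (wa , _) c = node1-child (child-covered a wa c)

  adjacent-covered : ∀ (t : SCD n) → WF t → ∀ {S S'} → AdjacentIn t S S' →
                     InSome (Together S S') (decomp t)
  adjacent-covered (union a b) (wa , _) (inj₁ c) =
    node2-left _ (decomp a) (decomp b) (adjacent-covered a wa c)
  adjacent-covered (union a b) (_ , wb , _) (inj₂ c) =
    node2-right _ (decomp a) (decomp b) (adjacent-covered b wb c)
  adjacent-covered (addVertex v a) (wa , _) c = node1-child (adjacent-covered a wa c)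
  adjacent-covered (merge S1 S2 a) (wa , _) c = node1-child (adjacent-covered a wa c)
  adjacent-covered (addArcs S1 S2 a) (_ , p1 , p2) (inj₁ (refl , refl)) = inBag zero (p1 , p2)
  adjacent-covered (addArcs S1 S2 a) (wa , _) (inj₂ c) = node1-child (adjacent-covered a wa c)

  together-sym : ∀ {S S' R} → InSome (Together S S') R → InSome (Together S' S) R
  together-sym (inBag x (p , q)) = inBag x (q , p)

  edge-covered : ∀ (t : SCD n) → WF t → ∀ {S S'} → RepEdge t S S' →
                 InSome (Together S S') (decomp t)
  edge-covered t w (inj₁ c)               = child-covered t w c
  edge-covered t w (inj₂ (inj₁ c))        = together-sym (child-covered t w c)
  edge-covered t w (inj₂ (inj₂ (inj₁ c))) = adjacent-covered t w c
  edge-covered t w (inj₂ (inj₂ (inj₂ c))) = together-sym (adjacent-covered t w c)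

lemma12 : (F : Circuit) (t : SCD (Circuit.n F)) (k : ℕ) →
          WF t → IsSCDOf F t → TypeRespecting F t → width t ≡ k →
          TreewidthAtMost (RepVertex t) (RepEdge t) k
lemma12 F t .(width t) wf _ _ refl = decomposition , λ x → proj₂ (small x)
  where
    small : ∀ x → Small (width t) (bag (decomp t) x)
    small = AllBags.holds (decomp-small t wf)

    decomposition : TreeDecomposition (RepVertex t) (RepEdge t)
    decomposition = record
      { m             = m (decomp t)
      ; parent        = parent (decomp t)
      ; parent<       = parent< (decomp t)
      ; bag           = bag (decomp t)
      ; bagUnique     = λ x → proj₁ (small x)
      ; bagVerts      = λ x → All.tabulate (λ p → occurs⇒label t (inBag x p))
      ; vertexCovered = λ _ p → witness (label⇒occurs t p)
      ; edgeCovered   = λ _ _ _ _ e → witness (edge-covered t wf e)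
      ; connected     = decomp-connected t wf
      }
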